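{- Let $T$ be a pre-Galois word and $p_e=\mathrm{Per}_e(T)$. Let $z$ be a symbol and $T'=T\cdot z$ with $T'[1..|T|-p_e+1]\succ_{\mathrm{alt}}T'[p_e+1..|T|+1]$. Let $\mathrm{SPref}(T')=T'[1..p]$. If $p=p_e$ and $|T|\ge 2p$, then $\mathrm{SPref}(T'[p+1..|T'|])=T'[p+1..2p]=T'[1..p]$.
   Context: $W[i..j]$ is the factor from position $i$ to $j$ (1-indexed), and is $\varepsilon$ if $i>j$. An integer $p\in[1..|W|]$ is a period of $W$ if $W[i+p]=W[i]$ for all $i\in[1..|W|-p]$. $\mathrm{Per}_e(W)$ is the shortest even period of $W$, set to $|W|+1$ if none exists. Alternating order: for words $S,T$ with $S^\omega\neq T^\omega$ ($X^\omega$ the infinite repetition of $X$), let $j$ be the first position with $S^\omega[j]\neq T^\omega[j]$; $S\prec_{\mathrm{alt}}T$ if $j$ is odd and $S^\omega[j]<T^\omega[j]$, or $j$ is even and $S^\omega[j]>T^\omega[j]$. $S=_{\mathrm{alt}}T$ if $S^\omega=T^\omega$; $\varepsilon\succ_{\mathrm{alt}}X$ for every nonempty $X$; $\preceq_{\mathrm{alt}}$ means $\prec_{\mathrm{alt}}$ or $=_{\mathrm{alt}}$, and $\succeq_{\mathrm{alt}}$ is its reverse. A word $T$ is pre-Galois if every proper suffix $S$ of $T$ is a prefix of $T$ or satisfies $S\succ_{\mathrm{alt}}T$. For a nonempty word $W$, $\mathrm{SPref}(W)$ is the shortest nonempty prefix $P$ of $W$ such that $P\succeq_{\mathrm{alt}}W$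 if $|P|$ is even and $P\preceq_{\mathrm{alt}}W$ if $|P|$ is odd. -}

module Defs where

open import Level using (Level)
open import Data.Nat using (ℕ; zero; suc; _+_; _*_; _∸_; _≤_; _<_; _%_)
open import Data.Nat.Properties using ()
open import Data.Nat.Divisibility using (_∣_)
open import Data.Empty.Polymorphic using (⊥)
open import Data.Unit.Polymorphic using (⊤)
open import Data.List using (List; []; _∷_; length; take; drop)
open import Data.Maybe using (Maybe; just; nothing)
open import Data.Product using (Σ; ∃; _×_; _,_)
open import Data.Sum using (_⊎_)
open import Relation.Binary.PropositionalEquality using (_≡_; _≢_)
open import Relation.Binary using (Rel)
open import Relation.Nullary using (¬_)

Word : ∀ {a} → Set a → Set a
Word A = List A

private
  variable
    a ℓ : Level
    A : Set a

Even : ℕ → Set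
Even n = 2 ∣ n

Odd : ℕ → Set
Odd n = ¬ (2 ∣ n)

-- 1-indexed letter access: W ! i = just W[i] for 1 ≤ i ≤ |W|, nothing otherwise.
_!_ : List A → ℕ → Maybe A
[]       ! _           = nothing
(x ∷ xs) ! zero        = nothing
(x ∷ xs) ! suc zero    = just x
(x ∷ xs) ! suc (suc i) = xs ! suc i

-- Factor W[i..j] (1-indexed), ε if i > j (and truncated at the end of W).
factor : List A → ℕ → ℕ → List A
factor W i j = take (suc j ∸ i) (drop (i ∸ 1) W)

-- 0-indexed access with a default value (default never used below).
nth : A → List A → ℕ → A
nth d []       _       = d
nth d (y ∷ ys) zero    = y
nth d (y ∷ ys) (suc n) = nth d ys n

-- X^ω for nonempty X = x ∷ xs, as a 1-indexed infinite sequence: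
-- X^ω[j] = X[((j-1) mod |X|) + 1].
omega : A → List A → ℕ → A
omega x xs j = nth x (x ∷ xs) ((j ∸ 1) % length (x ∷ xs))

AltLt : {A : Set a} → Rel A ℓ → List A → List A → Set _
AltLt _<ₐ_ []       _        = ⊥
AltLt _<ₐ_ (x ∷ xs) []       = ⊤
AltLt {A = A} _<ₐ_ (x ∷ xs) (y ∷ ys) =
  Σ ℕ λ j → 1 ≤ j
    × (∀ k → 1 ≤ k → k < j → omega x xs k ≡ omega y ys k)
    × ((Odd j × (omega x xs j <ₐ omega y ys j))
       ⊎ (Even j × (omega y ys j <ₐ omega x xs j)))

AltEq : List A → List A → Set _
AltEq []       []       = ⊤
AltEq []       (_ ∷ _)  = ⊥
AltEq (_ ∷ _)  []       = ⊥
AltEq (x ∷ xs) (y ∷ ys) = ∀ k → 1 ≤ k → omega x xs k ≡ omega y ys k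

AltLe : {A : Set a} → Rel A ℓ → List A → List A → Set _
AltLe _<ₐ_ S T = AltLt _<ₐ_ S T ⊎ AltEq S T

IsPrefix : List A → List A → Set _
IsPrefix P W = take (length P) W ≡ P

PreGalois : {A : Set a} → Rel A ℓ → List A → Set _
PreGalois _<ₐ_ T =
  ∀ k → 1 ≤ k → k ≤ length T →
    IsPrefix (drop k T) T ⊎ AltLt _<ₐ_ T (drop k T)

IsPeriod : ℕ → List A → Set _
IsPeriod p W = 1 ≤ p × p ≤ length W
  × (∀ i → 1 ≤ i → i + p ≤ length W → W ! (i + p) ≡ W ! i)

-- q = Per_e(W): shortest even period, |W|+1 if none exists.
IsPerE : List A → ℕ → Set _
IsPerE W q =
    (Even q × IsPeriod q W × (∀ q′ → Even q′ → IsPeriod q′ W → q ≤ q′))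
  ⊎ ((∀ q′ → Even q′ → ¬ IsPeriod q′ W) × q ≡ suc (length W))

SPrefCond : {A : Set a} → Rel A ℓ → List A → List A → Set _
SPrefCond _<ₐ_ W P =
  (Even (length P) × AltLe _<ₐ_ W P) ⊎ (Odd (length P) × AltLe _<ₐ_ P W)

IsSPref : {A : Set a} → Rel A ℓ → List A → List A → Set _
IsSPref _<ₐ_ W P =
  IsPrefix P W × 1 ≤ length P × SPrefCond _<ₐ_ W P
  × (∀ q → 1 ≤ q → q < length P → ¬ SPrefCond _<ₐ_ W (take q W))

{-# OPTIONS --safe #-}
-- Let n = |T|, L = n − p and S = T′[p+1..n+1]. As p is a period of T, S agrees with T on its
-- first L letters and ends with z, and both sides of the hypothesis on T′ have length L + 1, so it
-- says exactly that z is alt-below T[L+1] at position L + 1. Hence T′[p+1..2p] = T[1..p] satisfies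
-- the SPref condition for S, and it remains to show that a shorter prefix Q = T[1..q] satisfying
-- it for S would satisfy it for T′, against SPref(T′) = T′[1..p]. If Q^ω leaves T before position
-- L + 1, S and T′ compare with Q alike. Otherwise, for odd q the comparison at position L + 1
-- carries over through z; for even q, Q^ω cannot agree with T up to n (q would be a shorter even
-- period), nor first drop alt-below T at some c > L ≥ p: then the suffix of T after p − q letters
-- would be alt-smaller than T, first differing at c − p, and T is pre-Galois. So T′^ω ≺alt Q^ω.
module Submission where

open import Defs
open import Level using (Level)
open import Data.Nat using (ℕ; suc; _*_; _∸_; _≤_)
open import Data.List using (List; length; _∷_; []; _++_)
open import Data.Product using (_×_)
open import Relation.Binary using (Rel; IsStrictTotalOrder)
open import Relation.Binary.PropositionalEquality using (_≡_)

open import Level using (_⊔_)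
open import Data.Nat using (zero; _+_; _<_; z≤n; s≤s; _≤?_)
open import Data.Nat.Properties
open import Data.Nat.DivMod using ([m+n]%n≡m%n; m<n⇒m%n≡m)
open import Data.Nat.Divisibility using (_∣_; _∣?_; ∣m∣n⇒∣m+n; ∣m+n∣m⇒∣n)
open import Data.Nat.Induction using (<-rec)
open import Data.List using (take; drop)
open import Data.List.Properties using (length-++; length-take; length-drop; take-take)
open import Data.Maybe using (just)
open import Data.Maybe.Properties using (just-injective)
open import Data.Product using (∃; _,_; proj₁; proj₂; map₂)
open import Data.Sum using (_⊎_; inj₁; inj₂) renaming (map to ⊎-map)
open import Data.Empty using (⊥-elim)
open import Relation.Nullary using (¬_; yes; no)
open import Relation.Binary using (tri<; tri≈; tri>)
open import Relation.Binary.PropositionalEquality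
  using (_≢_; refl; sym; trans; cong; cong₂; subst; subst₂; module ≡-Reasoning)

module _ {a} {A : Set a} where

  !-take : ∀ m (X : List A) {k} → k ≤ m → take m X ! k ≡ X ! k
  !-take zero    []       z≤n = refl
  !-take zero    (x ∷ xs) z≤n = refl
  !-take (suc m) []       _   = refl
  !-take (suc m) (x ∷ xs) {zero}          _         = refl
  !-take (suc m) (x ∷ xs) {suc zero}      _         = refl
  !-take (suc m) (x ∷ xs) {suc (suc k)}   (s≤s k≤m) = !-take m xs k≤m

  !-drop : ∀ m (X : List A) {k} → 1 ≤ k → drop m X ! k ≡ X ! (k + m)
  !-drop zero    X        {k}     _ = cong (X !_) (sym (+-identityʳ k))
  !-drop (suc m) []       _         = refl
  !-drop (suc m) (x ∷ xs) {suc k} _ rewrite +-suc k m = !-drop m xs {suc k} (s≤s z≤n)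

  !-++ˡ : ∀ (X Y : List A) {k} → k ≤ length X → (X ++ Y) ! k ≡ X ! k
  !-++ˡ []       []      z≤n = refl
  !-++ˡ []       (_ ∷ _) z≤n = refl
  !-++ˡ (x ∷ xs) Y {zero}        _         = refl
  !-++ˡ (x ∷ xs) Y {suc zero}    _         = refl
  !-++ˡ (x ∷ xs) Y {suc (suc k)} (s≤s k≤n) = !-++ˡ xs Y k≤n

  !-++-∷ : ∀ (X : List A) y Y → (X ++ y ∷ Y) ! suc (length X) ≡ just y
  !-++-∷ []       y Y = refl
  !-++-∷ (x ∷ xs) y Y = !-++-∷ xs y Y

  !-nth : ∀ d (X : List A) {i} → i < length X → X ! suc i ≡ just (nth d X i)
  !-nth d (x ∷ xs) {zero}  _         = refl
  !-nth d (x ∷ xs) {suc i} (s≤s i<n) = !-nth d xs i<n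

  !≡just⇒inRange : ∀ (X : List A) k {x} → X ! k ≡ just x → 1 ≤ k × k ≤ length X
  !≡just⇒inRange (y ∷ ys) (suc zero)    _ = s≤s z≤n , s≤s z≤n
  !≡just⇒inRange (y ∷ ys) (suc (suc k)) e = s≤s z≤n , s≤s (proj₂ (!≡just⇒inRange ys (suc k) e))

  !-ext : ∀ (X Y : List A) → length X ≡ length Y →
          (∀ k → 1 ≤ k → k ≤ length X → X ! k ≡ Y ! k) → X ≡ Y
  !-ext []       []       _ _ = refl
  !-ext (x ∷ xs) (y ∷ ys) e h =
    cong₂ _∷_ (just-injective (h 1 (s≤s z≤n) (s≤s z≤n)))
              (!-ext xs ys (suc-injective e) λ where
                (suc k) _ k≤n → h (suc (suc k)) (s≤s z≤n) (s≤s k≤n))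

  length-take-≤ : ∀ m (X : List A) → m ≤ length X → length (take m X) ≡ m
  length-take-≤ m X m≤n = trans (length-take m X) (m≤n⇒m⊓n≡m m≤n)

  take-take-≤ : ∀ {m m′} (X : List A) → m ≤ m′ → take m (take m′ X) ≡ take m X
  take-take-≤ {m} {m′} X m≤m′ = trans (take-take m m′ X) (cong (λ i → take i X) (m≤n⇒m⊓n≡m m≤m′))

module _ {a} {A : Set a} where

  Agree : ℕ → (ℕ → A) → (ℕ → A) → Set a
  Agree c f g = ∀ k → 1 ≤ k → k < c → f k ≡ g k

  Period : ℕ → (ℕ → A) → Set a
  Period q f = ∀ k → 1 ≤ k → f (k + q) ≡ f k

  PeriodUpTo : ℕ → ℕ → (ℕ → A) → Set a
  PeriodUpTo B q f = ∀ k → 1 ≤ k → k + q ≤ B → f (k + q) ≡ f k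

  Agree-sym : ∀ {c} {f g : ℕ → A} → Agree c f g → Agree c g f
  Agree-sym ag k 1≤k k<c = sym (ag k 1≤k k<c)

  Agree-trans : ∀ {c} {f g h : ℕ → A} → Agree c f g → Agree c g h → Agree c f h
  Agree-trans fg gh k 1≤k k<c = trans (fg k 1≤k k<c) (gh k 1≤k k<c)

  Agree-≤ : ∀ {c c′} {f g : ℕ → A} → c′ ≤ c → Agree c f g → Agree c′ f g
  Agree-≤ c′≤c ag k 1≤k k<c′ = ag k 1≤k (<-≤-trans k<c′ c′≤c)

  Agree-suc : ∀ {c} {f g : ℕ → A} → Agree c f g → f c ≡ g c → Agree (suc c) f g
  Agree-suc {c} ag e k 1≤k k<1+c with m≤n⇒m<n∨m≡n (≤-pred k<1+c)
  ... | inj₁ k<c  = ag k 1≤k k<c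
  ... | inj₂ refl = e

  periodic-agree : ∀ {q B} {f g : ℕ → A} → 1 ≤ q → PeriodUpTo B q f → PeriodUpTo B q g →
                   Agree (suc q) f g → Agree (suc B) f g
  periodic-agree {q} {B} {f} {g} 1≤q f-per g-per base k 1≤k k<1+B =
    <-rec Claim step k 1≤k (≤-pred k<1+B)
    where
    Claim : ℕ → Set a
    Claim k = 1 ≤ k → k ≤ B → f k ≡ g k
    step : ∀ k → (∀ {m} → m < k → Claim m) → Claim k
    step k rec 1≤k k≤B with k ≤? q
    ... | yes k≤q = base k 1≤k (s≤s k≤q)
    ... | no  k≰q = begin
      f k       ≡⟨ cong f (sym m+q≡k) ⟩
      f (m + q) ≡⟨ f-per m 1≤m m+q≤B ⟩
      f m       ≡⟨ rec (∸-monoʳ-< 1≤q q≤k) 1≤m (≤-trans (m∸n≤m k q) k≤B) ⟩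
      g m       ≡⟨ sym (g-per m 1≤m m+q≤B) ⟩
      g (m + q) ≡⟨ cong g m+q≡k ⟩
      g k       ∎
      where
      open ≡-Reasoning
      m : ℕ
      m = k ∸ q
      q<k : q < k
      q<k = ≰⇒> k≰q
      q≤k : q ≤ k
      q≤k = <⇒≤ q<k
      m+q≡k : m + q ≡ k
      m+q≡k = m∸n+n≡m q≤k
      1≤m : 1 ≤ m
      1≤m = m<n⇒0<n∸m q<k
      m+q≤B : m + q ≤ B
      m+q≤B = subst (_≤ B) (sym m+q≡k) k≤B

module Powers {a} {A : Set a} (junk : A) where

  infix 10 _^ω_

  -- The value for X = [] is junk: `omega` is only defined on nonempty words.
  _^ω_ : List A → ℕ → A
  []       ^ω _ = junk
  (x ∷ xs) ^ω k = omega x xs k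

  ^ω-! : ∀ X {k} → 1 ≤ k → k ≤ length X → X ! k ≡ just (X ^ω k)
  ^ω-! (x ∷ xs) {suc i} _ i<n =
    trans (!-nth x (x ∷ xs) i<n) (cong (λ j → just (nth x (x ∷ xs) j)) (sym (m<n⇒m%n≡m i<n)))

  ^ω-period : ∀ X {m} → length X ≡ m → Period m (X ^ω_)
  ^ω-period []       refl _       _ = refl
  ^ω-period (x ∷ xs) refl (suc i) _ = cong (nth x (x ∷ xs)) ([m+n]%n≡m%n i (length (x ∷ xs)))

  !≡just⇒^ω : ∀ X {k x} → X ! k ≡ just x → X ^ω k ≡ x
  !≡just⇒^ω X {k} e with !≡just⇒inRange X k e
  ... | 1≤k , k≤n = just-injective (trans (sym (^ω-! X 1≤k k≤n)) e)

  ^ω-cong : ∀ X Y {k} → X ! k ≡ Y ! k → 1 ≤ k → k ≤ length Y → X ^ω k ≡ Y ^ω k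
  ^ω-cong X Y e 1≤k k≤n = !≡just⇒^ω X (trans e (^ω-! Y 1≤k k≤n))

module AltOrder {a ℓ} {A : Set a} {_<ₐ_ : Rel A ℓ} (sto : IsStrictTotalOrder _≡_ _<ₐ_) where
  open IsStrictTotalOrder sto using (compare; irrefl; asym)
    renaming (_≟_ to _≟ₐ_; trans to <ₐ-trans)

  infix 4 _<[_]_

  _<[_]_ : A → ℕ → A → Set ℓ
  x <[ j ] y = (Odd j × x <ₐ y) ⊎ (Even j × y <ₐ x)

  <[]-≢ : ∀ {j x y} → x <[ j ] y → x ≢ y
  <[]-≢ (inj₁ (_ , x<y)) refl = irrefl refl x<y
  <[]-≢ (inj₂ (_ , y<x)) refl = irrefl refl y<x

  <[]-asym : ∀ {j x y} → x <[ j ] y → ¬ (y <[ j ] x)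
  <[]-asym (inj₁ (_ , x<y)) (inj₁ (_ , y<x)) = asym x<y y<x
  <[]-asym (inj₁ (o , _))   (inj₂ (e , _))   = o e
  <[]-asym (inj₂ (e , _))   (inj₁ (o , _))   = o e
  <[]-asym (inj₂ (_ , y<x)) (inj₂ (_ , x<y)) = asym y<x x<y

  <[]-trans : ∀ {j x y w} → x <[ j ] y → y <[ j ] w → x <[ j ] w
  <[]-trans (inj₁ (o , x<y)) (inj₁ (_ , y<w)) = inj₁ (o , <ₐ-trans x<y y<w)
  <[]-trans (inj₁ (o , _))   (inj₂ (e , _))   = ⊥-elim (o e)
  <[]-trans (inj₂ (e , _))   (inj₁ (o , _))   = ⊥-elim (o e)
  <[]-trans (inj₂ (e , y<x)) (inj₂ (_ , w<y)) = inj₂ (e , <ₐ-trans w<y y<x)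

  <[]-connex : ∀ j {x y} → x ≢ y → x <[ j ] y ⊎ y <[ j ] x
  <[]-connex j {x} {y} x≢y with 2 ∣? j | compare x y
  ... | _     | tri≈ _ x≡y _ = ⊥-elim (x≢y x≡y)
  ... | no  o | tri< x<y _ _ = inj₁ (inj₁ (o , x<y))
  ... | no  o | tri> _ _ y<x = inj₂ (inj₁ (o , y<x))
  ... | yes e | tri< x<y _ _ = inj₂ (inj₂ (e , x<y))
  ... | yes e | tri> _ _ y<x = inj₁ (inj₂ (e , y<x))

  <[]-shift : ∀ {g p x y} → Even p → x <[ g + p ] y → x <[ g ] y
  <[]-shift {g} {p} e-p (inj₁ (o , x<y)) = inj₁ ((λ e-g → o (∣m∣n⇒∣m+n e-g e-p)) , x<y)
  <[]-shift {g} {p} e-p (inj₂ (e , y<x)) = inj₂ (∣m+n∣m⇒∣n (subst (2 ∣_) (+-comm g p) e) e-p , y<x)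

  FirstDiff : (ℕ → A) → (ℕ → A) → ℕ → Set (a ⊔ ℓ)
  FirstDiff f g j = 1 ≤ j × Agree j f g × f j <[ j ] g j

  Mismatch : ℕ → (ℕ → A) → (ℕ → A) → Set a
  Mismatch c f g = 1 ≤ c × Agree c f g × f c ≢ g c

  infix 4 _≺_ _≼_

  _≺_ : (ℕ → A) → (ℕ → A) → Set (a ⊔ ℓ)
  f ≺ g = ∃ (FirstDiff f g)

  _≼_ : (ℕ → A) → (ℕ → A) → Set (a ⊔ ℓ)
  f ≼ g = f ≺ g ⊎ (∀ k → 1 ≤ k → f k ≡ g k)

  FirstDiff⇒Mismatch : ∀ {f g j} → FirstDiff f g j → Mismatch j f g
  FirstDiff⇒Mismatch (1≤j , ag , lt) = 1≤j , ag , <[]-≢ lt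

  Mismatch-sym : ∀ {f g c} → Mismatch c f g → Mismatch c g f
  Mismatch-sym (1≤c , ag , ne) = 1≤c , Agree-sym ag , λ e → ne (sym e)

  FirstDiff-connex : ∀ {f g c} → Mismatch c f g → FirstDiff f g c ⊎ FirstDiff g f c
  FirstDiff-connex {c = c} (1≤c , ag , ne) with <[]-connex c ne
  ... | inj₁ lt = inj₁ (1≤c , ag , lt)
  ... | inj₂ gt = inj₂ (1≤c , Agree-sym ag , gt)

  Mismatch-congˡ : ∀ {f f′ g c} → Agree (suc c) f f′ → Mismatch c f g → Mismatch c f′ g
  Mismatch-congˡ {c = c} ff′ (1≤c , ag , ne) =
    1≤c , Agree-trans (Agree-sym (Agree-≤ (n≤1+n c) ff′)) ag , λ e → ne (trans (ff′ c 1≤c ≤-refl) e)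

  FirstDiff-cong : ∀ {f f′ g g′ c} → Agree (suc c) f f′ → Agree (suc c) g g′ →
                   FirstDiff f g c → FirstDiff f′ g′ c
  FirstDiff-cong {c = c} ff′ gg′ (1≤c , ag , lt) =
    1≤c ,
    Agree-trans (Agree-sym (Agree-≤ (n≤1+n c) ff′)) (Agree-trans ag (Agree-≤ (n≤1+n c) gg′)) ,
    subst₂ (_<[ c ]_) (ff′ c 1≤c ≤-refl) (gg′ c 1≤c ≤-refl) lt

  ≼-pinned : ∀ {f g c} → Mismatch c f g → f ≼ g → FirstDiff f g c
  ≼-pinned (1≤c , _ , ne) (inj₂ f≗g) = ⊥-elim (ne (f≗g _ 1≤c))
  ≼-pinned {c = c} (1≤c , ag , ne) (inj₁ (j , 1≤j , agⱼ , lt)) with <-cmp j c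
  ... | tri< j<c _ _ = ⊥-elim (<[]-≢ lt (ag j 1≤j j<c))
  ... | tri≈ _ refl _ = 1≤j , agⱼ , lt
  ... | tri> _ _ c<j = ⊥-elim (ne (agⱼ c 1≤c c<j))

  ≺-asym : ∀ {f g} → f ≺ g → ¬ (g ≺ f)
  ≺-asym (j , fd) g≺f = <[]-asym (proj₂ (proj₂ fd))
    (proj₂ (proj₂ (≼-pinned (Mismatch-sym (FirstDiff⇒Mismatch fd)) (inj₁ g≺f))))

  ≼⇒¬≻ : ∀ {f g} → f ≼ g → ¬ (g ≺ f)
  ≼⇒¬≻ (inj₁ f≺g) g≺f                   = ≺-asym f≺g g≺f
  ≼⇒¬≻ (inj₂ f≗g) (j , 1≤j , _ , lt) = <[]-≢ lt (sym (f≗g j 1≤j))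

  firstMismatch? : ∀ f g B → Agree (suc B) f g ⊎ ∃ λ c → c ≤ B × Mismatch c f g
  firstMismatch? f g zero = inj₁ λ { k 1≤k (s≤s k≤0) → ⊥-elim (<⇒≱ 1≤k k≤0) }
  firstMismatch? f g (suc B) with firstMismatch? f g B
  ... | inj₂ (c , c≤B , mm) = inj₂ (c , m≤n⇒m≤1+n c≤B , mm)
  ... | inj₁ ag with f (suc B) ≟ₐ g (suc B)
  ...   | yes e  = inj₁ (Agree-suc ag e)
  ...   | no  ne = inj₂ (suc B , ≤-refl , s≤s z≤n , ag , ne)

  periodic-≺⇒<[] : ∀ {c f g} → 1 ≤ c → Period c f → Period c g → Agree c f g → f ≺ g → f c <[ c ] g c
  periodic-≺⇒<[] {c} {f} {g} 1≤c f-per g-per ag f≺g@(j , 1≤j , _ , lt) with f c ≟ₐ g c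
  ... | no  ne = proj₂ (proj₂ (≼-pinned (1≤c , ag , ne) (inj₁ f≺g)))
  ... | yes e  = ⊥-elim (<[]-≢ lt (periodic-agree 1≤c (λ k 1≤k _ → f-per k 1≤k) (λ k 1≤k _ → g-per k 1≤k)
                                     (Agree-suc ag e) j 1≤j ≤-refl))

module Words {a ℓ} {A : Set a} {_<ₐ_ : Rel A ℓ} (sto : IsStrictTotalOrder _≡_ _<ₐ_) (junk : A) where
  open AltOrder sto
  open Powers junk

  AltLt⇒≺ : ∀ X Y → 1 ≤ length X → 1 ≤ length Y → AltLt _<ₐ_ X Y → (X ^ω_) ≺ (Y ^ω_)
  AltLt⇒≺ (_ ∷ _) (_ ∷ _) _ _ lt = lt

  SPrefCond⇒≼ : ∀ V P → 1 ≤ length V → 1 ≤ length P → SPrefCond _<ₐ_ V P →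
               (Even (length P) × (V ^ω_) ≼ (P ^ω_)) ⊎ (Odd (length P) × (P ^ω_) ≼ (V ^ω_))
  SPrefCond⇒≼ (_ ∷ _) (_ ∷ _) _ _ cond = cond

  ≼⇒SPrefCond : ∀ V P → 1 ≤ length V → 1 ≤ length P →
               (Even (length P) × (V ^ω_) ≼ (P ^ω_)) ⊎ (Odd (length P) × (P ^ω_) ≼ (V ^ω_)) →
               SPrefCond _<ₐ_ V P
  ≼⇒SPrefCond (_ ∷ _) (_ ∷ _) _ _ cond = cond

  preGalois⇒¬suffix≺ : ∀ T {r g} → PreGalois _<ₐ_ T → 1 ≤ r → r ≤ length T → g ≤ length T ∸ r →
                       ¬ FirstDiff (drop r T ^ω_) (T ^ω_) g
  preGalois⇒¬suffix≺ T {r} {g} pg 1≤r r≤n g≤n∸r fd@(1≤g , _ , lt) with pg r 1≤r r≤n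
  ... | inj₁ prefix = <[]-≢ lt (^ω-cong U T U!g≡T!g 1≤g (≤-trans g≤n∸r (m∸n≤m _ r)))
    where
    U : List A
    U = drop r T
    U!g≡T!g : U ! g ≡ T ! g
    U!g≡T!g = trans (cong (_! g) (sym prefix))
                    (!-take (length U) T (subst (g ≤_) (sym (length-drop r T)) g≤n∸r))
  ... | inj₂ T≺U = ≺-asym (AltLt⇒≺ T (drop r T) (≤-trans 1≤r r≤n) 1≤|U| T≺U) (g , fd)
    where
    1≤|U| : 1 ≤ length (drop r T)
    1≤|U| = subst (1 ≤_) (sym (length-drop r T)) (≤-trans 1≤g g≤n∸r)

  -- Otherwise the suffix drop (p ∸ q) T of T would be alt-smaller than T, first differing at c ∸ p.
  preGalois⇒periodic≮ : ∀ T {p q c} (u : ℕ → A) → PreGalois _<ₐ_ T → Even p →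
    PeriodUpTo (length T) p (T ^ω_) → 1 ≤ q → q < p → Period q u →
    p < c → c ≤ length T → Agree c u (T ^ω_) → ¬ (u c <[ c ] T ^ω c)
  preGalois⇒periodic≮ T {p} {q} {c} u pg even-p t-per 1≤q q<p u-per p<c c≤n agree lt =
    preGalois⇒¬suffix≺ T pg (m<n⇒0<n∸m q<p) r≤n g≤n∸r (m<n⇒0<n∸m p<c , U-agree , U-at-g)
    where
    n r g : ℕ
    n = length T
    r = p ∸ q
    g = c ∸ p
    t : ℕ → A
    t = T ^ω_
    U : List A
    U = drop r T
    g+p≡c : g + p ≡ c
    g+p≡c = m∸n+n≡m (<⇒≤ p<c)
    r≤p : r ≤ p
    r≤p = m∸n≤m p q
    r≤n : r ≤ n
    r≤n = ≤-trans r≤p (≤-trans (<⇒≤ p<c) c≤n)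
    g≤n∸r : g ≤ n ∸ r
    g≤n∸r = m+n≤o⇒m≤o∸n g (≤-trans (+-monoʳ-≤ g r≤p) (subst (_≤ n) (sym g+p≡c) c≤n))
    i+r+q≡i+p : ∀ i → i + r + q ≡ i + p
    i+r+q≡i+p i = trans (+-assoc i r q) (cong (i +_) (m∸n+n≡m (<⇒≤ q<p)))
    i+p<c : ∀ {i} → i < g → i + p < c
    i+p<c i<g = subst (_ <_) g+p≡c (+-monoˡ-< p i<g)
    i+r<c : ∀ {i} → i ≤ g → i + r < c
    i+r<c {i} i≤g = begin-strict
      i + r     <⟨ m<m+n (i + r) 1≤q ⟩
      i + r + q ≡⟨ i+r+q≡i+p i ⟩
      i + p     ≤⟨ +-monoˡ-≤ p i≤g ⟩
      g + p     ≡⟨ g+p≡c ⟩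
      c         ∎
      where open ≤-Reasoning
    U-shift : ∀ {i} → 1 ≤ i → i ≤ g → U ^ω i ≡ u (i + p)
    U-shift {i} 1≤i i≤g = begin
      U ^ω i         ≡⟨ !≡just⇒^ω U (trans (!-drop r T 1≤i) (^ω-! T 1≤i+r (≤-trans (<⇒≤ (i+r<c i≤g)) c≤n))) ⟩
      t (i + r)      ≡⟨ sym (agree (i + r) 1≤i+r (i+r<c i≤g)) ⟩
      u (i + r)      ≡⟨ sym (u-per (i + r) 1≤i+r) ⟩
      u (i + r + q)  ≡⟨ cong u (i+r+q≡i+p i) ⟩
      u (i + p)      ∎
      where
      open ≡-Reasoning
      1≤i+r : 1 ≤ i + r
      1≤i+r = ≤-trans 1≤i (m≤m+n i r)
    t-shift : ∀ {i} → 1 ≤ i → i ≤ g → t (i + p) ≡ t i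
    t-shift {i} 1≤i i≤g = t-per i 1≤i (≤-trans (+-monoˡ-≤ p i≤g) (subst (_≤ n) (sym g+p≡c) c≤n))
    U-agree : Agree g (U ^ω_) t
    U-agree i 1≤i i<g =
      trans (U-shift 1≤i (<⇒≤ i<g))
            (trans (agree (i + p) (≤-trans 1≤i (m≤m+n i p)) (i+p<c i<g)) (t-shift 1≤i (<⇒≤ i<g)))
    1≤g : 1 ≤ g
    1≤g = m<n⇒0<n∸m p<c
    U-at-g : U ^ω g <[ g ] t g
    U-at-g = subst₂ (_<[ g ]_) (sym (U-shift 1≤g ≤-refl)) (t-shift 1≤g ≤-refl)
               (<[]-shift even-p (subst (λ j → u j <[ j ] t j) (sym g+p≡c) lt))

-- In the notation of the statement W = T′, S = T′[p+1..|T′|] and P = T′[p+1..2p].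
module SuffixSPref {a ℓ} {A : Set a} {_<ₐ_ : Rel A ℓ} (sto : IsStrictTotalOrder _≡_ _<ₐ_)
  (T : List A) (pg : PreGalois _<ₐ_ T) (z : A) (p : ℕ)
  (even-p : Even p) (p-period : IsPeriod p T) (p-minimal : ∀ q → Even q → IsPeriod q T → p ≤ q)
  (2p≤n : 2 * p ≤ length T)
  (W-suffix≺ : AltLt _<ₐ_ (factor (T ++ z ∷ []) (suc p) (suc (length T)))
                          (factor (T ++ z ∷ []) 1 (suc (length T) ∸ p)))
  where
  open IsStrictTotalOrder sto using () renaming (_≟_ to _≟ₐ_)
  open AltOrder sto
  open Powers z
  open Words sto z

  n L : ℕ
  n = length T
  L = n ∸ p

  W D S P : List A
  W = T ++ z ∷ []
  D = drop p W
  S = take (suc L) D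
  P = take p D

  t : ℕ → A
  t = T ^ω_

  1≤p : 1 ≤ p
  1≤p = proj₁ p-period

  p+p≤n : p + p ≤ n
  p+p≤n = subst (_≤ n) (cong (p +_) (+-identityʳ p)) 2p≤n

  p≤n : p ≤ n
  p≤n = ≤-trans (m≤m+n p p) p+p≤n

  p≤L : p ≤ L
  p≤L = m+n≤o⇒m≤o∸n p p+p≤n

  L+p≡n : L + p ≡ n
  L+p≡n = m∸n+n≡m p≤n

  L<n : L < n
  L<n = subst (L <_) L+p≡n (m<m+n L 1≤p)

  L≤n : L ≤ n
  L≤n = <⇒≤ L<n

  1+n∸p≡1+L : suc n ∸ p ≡ suc L
  1+n∸p≡1+L = +-∸-assoc 1 p≤n

  |W| : length W ≡ suc n
  |W| = trans (length-++ T) (+-comm n 1)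

  |D| : length D ≡ suc L
  |D| = trans (length-drop p W) (trans (cong (_∸ p) |W|) 1+n∸p≡1+L)

  |S| : length S ≡ suc L
  |S| = length-take-≤ (suc L) D (≤-reflexive (sym |D|))

  |P| : length P ≡ p
  |P| = length-take-≤ p D (subst (p ≤_) (sym |D|) (m≤n⇒m≤1+n p≤L))

  |take-p-W| : length (take p W) ≡ p
  |take-p-W| = length-take-≤ p W (subst (p ≤_) (sym |W|) (m≤n⇒m≤1+n p≤n))

  1≤|W| : 1 ≤ length W
  1≤|W| = subst (1 ≤_) (sym |W|) (s≤s z≤n)

  1≤|S| : 1 ≤ length S
  1≤|S| = subst (1 ≤_) (sym |S|) (s≤s z≤n)

  1≤|P| : 1 ≤ length P
  1≤|P| = subst (1 ≤_) (sym |P|) 1≤p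

  W!k : ∀ {k} → k ≤ n → W ! k ≡ T ! k
  W!k = !-++ˡ T (z ∷ [])

  D!k : ∀ {k} → 1 ≤ k → k ≤ L → D ! k ≡ T ! k
  D!k {k} 1≤k k≤L = begin
    D ! k        ≡⟨ !-drop p W 1≤k ⟩
    W ! (k + p)  ≡⟨ W!k k+p≤n ⟩
    T ! (k + p)  ≡⟨ proj₂ (proj₂ p-period) k 1≤k k+p≤n ⟩
    T ! k        ∎
    where
    open ≡-Reasoning
    k+p≤n : k + p ≤ n
    k+p≤n = subst (k + p ≤_) L+p≡n (+-monoˡ-≤ p k≤L)

  D!1+L : D ! suc L ≡ just z
  D!1+L = trans (!-drop p W (s≤s z≤n)) (trans (cong (λ k → W ! suc k) L+p≡n) (!-++-∷ T z []))

  t-period : PeriodUpTo n p t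
  t-period k 1≤k k+p≤n =
    !≡just⇒^ω T (trans (proj₂ (proj₂ p-period) k 1≤k k+p≤n) (^ω-! T 1≤k (≤-trans (m≤m+n k p) k+p≤n)))

  W≈t : Agree (suc n) (W ^ω_) t
  W≈t k 1≤k (s≤s k≤n) = ^ω-cong W T (W!k k≤n) 1≤k k≤n

  S≈t : Agree (suc L) (S ^ω_) t
  S≈t k 1≤k (s≤s k≤L) =
    ^ω-cong S T (trans (!-take (suc L) D (m≤n⇒m≤1+n k≤L)) (D!k 1≤k k≤L)) 1≤k (≤-trans k≤L L≤n)

  S-last : S ^ω suc L ≡ z
  S-last = !≡just⇒^ω S (trans (!-take (suc L) D ≤-refl) D!1+L)

  P≈t : Agree (suc n) (P ^ω_) t
  P≈t = periodic-agree 1≤p (λ k 1≤k _ → ^ω-period P |P| k 1≤k) t-period P≈t-initial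
    where
    P≈t-initial : Agree (suc p) (P ^ω_) t
    P≈t-initial k 1≤k (s≤s k≤p) =
      ^ω-cong P T (trans (!-take p D k≤p) (D!k 1≤k (≤-trans k≤p p≤L))) 1≤k (≤-trans k≤p p≤n)

  P≡take-p-W : P ≡ take p W
  P≡take-p-W = !-ext P (take p W) (trans |P| (sym |take-p-W|)) P!k≡
    where
    P!k≡ : ∀ k → 1 ≤ k → k ≤ length P → P ! k ≡ take p W ! k
    P!k≡ k 1≤k k≤|P| = begin
      P ! k          ≡⟨ !-take p D k≤p ⟩
      D ! k          ≡⟨ D!k 1≤k (≤-trans k≤p p≤L) ⟩
      T ! k          ≡⟨ sym (W!k (≤-trans k≤p p≤n)) ⟩
      W ! k          ≡⟨ sym (!-take p W k≤p) ⟩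
      take p W ! k   ∎
      where
      open ≡-Reasoning
      k≤p : k ≤ p
      k≤p = subst (k ≤_) |P| k≤|P|

  -- Both sides of W-suffix≺ have period L + 1 and agree before it, so they are compared there.
  z<[1+L] : z <[ suc L ] t (suc L)
  z<[1+L] = subst₂ (_<[ suc L ]_) S-last (R≈t (suc L) (s≤s z≤n) ≤-refl)
    (periodic-≺⇒<[] (s≤s z≤n) (^ω-period S |S|) (^ω-period R |R|) S≈R S≺R)
    where
    R : List A
    R = take (suc L) W
    |R| : length R ≡ suc L
    |R| = length-take-≤ (suc L) W (subst (suc L ≤_) (sym |W|) (s≤s L≤n))
    R≈t : Agree (suc (suc L)) (R ^ω_) t
    R≈t k 1≤k (s≤s k≤1+L) =
      ^ω-cong R T (trans (!-take (suc L) W k≤1+L) (W!k (≤-trans k≤1+L L<n))) 1≤k (≤-trans k≤1+L L<n)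
    S≈R : Agree (suc L) (S ^ω_) (R ^ω_)
    S≈R = Agree-trans S≈t (Agree-sym (Agree-≤ (n≤1+n _) R≈t))
    S≺R : (S ^ω_) ≺ (R ^ω_)
    S≺R = AltLt⇒≺ S R 1≤|S| (subst (1 ≤_) (sym |R|) (s≤s z≤n))
            (subst (λ m → AltLt _<ₐ_ (take m D) (take m W)) 1+n∸p≡1+L W-suffix≺)

  S-cond : SPrefCond _<ₐ_ S P
  S-cond = ≼⇒SPrefCond S P 1≤|S| 1≤|P|
    (inj₁ (subst Even (sym |P|) even-p , inj₁ (suc L , s≤s z≤n , S≈P , S<P-at-1+L)))
    where
    P≈t′ : Agree (suc (suc L)) (P ^ω_) t
    P≈t′ = Agree-≤ (s≤s L<n) P≈t
    S≈P : Agree (suc L) (S ^ω_) (P ^ω_)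
    S≈P = Agree-trans S≈t (Agree-sym (Agree-≤ (n≤1+n _) P≈t′))
    S<P-at-1+L : S ^ω suc L <[ suc L ] P ^ω suc L
    S<P-at-1+L = subst₂ (_<[ suc L ]_) (sym S-last) (sym (P≈t′ (suc L) (s≤s z≤n) ≤-refl)) z<[1+L]

  module ShorterPrefix {q} (1≤q : 1 ≤ q) (q<p : q < p) where

    Q : List A
    Q = take q W

    u : ℕ → A
    u = Q ^ω_

    q≤n : q ≤ n
    q≤n = ≤-trans (<⇒≤ q<p) p≤n

    |Q| : length Q ≡ q
    |Q| = length-take-≤ q W (subst (q ≤_) (sym |W|) (m≤n⇒m≤1+n q≤n))

    1≤|Q| : 1 ≤ length Q
    1≤|Q| = subst (1 ≤_) (sym |Q|) 1≤q

    agree⇒IsPeriod : Agree (suc n) u t → IsPeriod q T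
    agree⇒IsPeriod u≈t = 1≤q , q≤n , λ i 1≤i i+q≤n → begin
      T ! (i + q)       ≡⟨ ^ω-! T (≤-trans 1≤i (m≤m+n i q)) i+q≤n ⟩
      just (t (i + q))  ≡⟨ cong just (sym (u≈t (i + q) (≤-trans 1≤i (m≤m+n i q)) (s≤s i+q≤n))) ⟩
      just (u (i + q))  ≡⟨ cong just (^ω-period Q |Q| i 1≤i) ⟩
      just (u i)        ≡⟨ cong just (u≈t i 1≤i (s≤s (≤-trans (m≤m+n i q) i+q≤n))) ⟩
      just (t i)        ≡⟨ sym (^ω-! T 1≤i (≤-trans (m≤m+n i q) i+q≤n)) ⟩
      T ! i             ∎
      where open ≡-Reasoning

    early-mismatch-transfer : ∀ {c} → c ≤ L → Mismatch c u t → SPrefCond _<ₐ_ S Q → SPrefCond _<ₐ_ W Q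
    early-mismatch-transfer {c} c≤L mm cond =
      ≼⇒SPrefCond W Q 1≤|W| 1≤|Q| (⊎-map (map₂ S≼u⇒W≼u) (map₂ u≼S⇒u≼W) (SPrefCond⇒≼ S Q 1≤|S| 1≤|Q| cond))
      where
      S≈W : Agree (suc c) (S ^ω_) (W ^ω_)
      S≈W = Agree-trans (Agree-≤ (s≤s c≤L) S≈t) (Agree-sym (Agree-≤ (s≤s (≤-trans c≤L L≤n)) W≈t))
      u≈u : Agree (suc c) u u
      u≈u _ _ _ = refl
      S-mm : Mismatch c (S ^ω_) u
      S-mm = Mismatch-congˡ (Agree-sym (Agree-≤ (s≤s c≤L) S≈t)) (Mismatch-sym mm)
      S≼u⇒W≼u : (S ^ω_) ≼ u → (W ^ω_) ≼ u
      S≼u⇒W≼u S≼u = inj₁ (c , FirstDiff-cong S≈W u≈u (≼-pinned S-mm S≼u))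
      u≼S⇒u≼W : u ≼ (S ^ω_) → u ≼ (W ^ω_)
      u≼S⇒u≼W u≼S = inj₁ (c , FirstDiff-cong u≈u S≈W (≼-pinned (Mismatch-sym S-mm) u≼S))

    module _ (u≈t : Agree (suc L) u t) where

      S≺u : z <[ suc L ] u (suc L) → (S ^ω_) ≺ u
      S≺u lt = suc L , s≤s z≤n , Agree-trans S≈t (Agree-sym u≈t) ,
               subst (_<[ suc L ] u (suc L)) (sym S-last) lt

      u≺W : u (suc L) <[ suc L ] t (suc L) → u ≺ (W ^ω_)
      u≺W lt = suc L , s≤s z≤n , Agree-trans u≈t (Agree-sym (Agree-≤ (s≤s L≤n) W≈t)) ,
               subst (u (suc L) <[ suc L ]_) (sym (W≈t (suc L) (s≤s z≤n) (s≤s L<n))) lt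

      odd-transfer : u ≼ (S ^ω_) → u ≺ (W ^ω_)
      odd-transfer u≼S with u (suc L) ≟ₐ t (suc L)
      ... | yes x≡y = ⊥-elim (≼⇒¬≻ u≼S (S≺u (subst (z <[ suc L ]_) (sym x≡y) z<[1+L])))
      ... | no  x≢y with <[]-connex (suc L) x≢y
      ...   | inj₁ x<y = u≺W x<y
      ...   | inj₂ y<x = ⊥-elim (≼⇒¬≻ u≼S (S≺u (<[]-trans z<[1+L] y<x)))

      even⇒W≺u : Even q → (W ^ω_) ≺ u
      even⇒W≺u even-q with firstMismatch? u t n
      ... | inj₁ u≈tₙ = ⊥-elim (<⇒≱ q<p (p-minimal q even-q (agree⇒IsPeriod u≈tₙ)))
      ... | inj₂ (c , c≤n , mm@(1≤c , agree , u≢t)) with FirstDiff-connex mm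
      ...   | inj₁ (_ , _ , u<t) =
        ⊥-elim (preGalois⇒periodic≮ T u pg even-p t-period 1≤q q<p (^ω-period Q |Q|) p<c c≤n agree u<t)
        where
        p<c : p < c
        p<c = ≤-<-trans p≤L (≰⇒> λ c≤L → u≢t (u≈t c 1≤c (s≤s c≤L)))
      ...   | inj₂ t≺u = c , FirstDiff-cong (Agree-sym (Agree-≤ (s≤s c≤n) W≈t)) (λ _ _ _ → refl) t≺u

    SPrefCond-S⇒W : SPrefCond _<ₐ_ S Q → SPrefCond _<ₐ_ W Q
    SPrefCond-S⇒W cond with firstMismatch? u t L
    ... | inj₂ (c , c≤L , mm) = early-mismatch-transfer c≤L mm cond
    ... | inj₁ u≈t with SPrefCond⇒≼ S Q 1≤|S| 1≤|Q| cond
    ...   | inj₁ (even-Q , _) =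
      ≼⇒SPrefCond W Q 1≤|W| 1≤|Q| (inj₁ (even-Q , inj₁ (even⇒W≺u u≈t (subst Even |Q| even-Q))))
    ...   | inj₂ (odd-Q , u≼S) =
      ≼⇒SPrefCond W Q 1≤|W| 1≤|Q| (inj₂ (odd-Q , inj₁ (odd-transfer u≈t u≼S)))

  take-q-S≡take-q-W : ∀ {q} → q ≤ p → take q S ≡ take q W
  take-q-S≡take-q-W {q} q≤p = begin
    take q S           ≡⟨ take-take-≤ D (≤-trans q≤p (m≤n⇒m≤1+n p≤L)) ⟩
    take q D           ≡⟨ sym (take-take-≤ D q≤p) ⟩
    take q P           ≡⟨ cong (take q) P≡take-p-W ⟩
    take q (take p W)  ≡⟨ take-take-≤ W q≤p ⟩
    take q W           ∎
    where open ≡-Reasoning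

  S-SPref : (∀ q → 1 ≤ q → q < p → ¬ SPrefCond _<ₐ_ W (take q W)) → IsSPref _<ₐ_ S P
  S-SPref W-minimal = P-prefix , 1≤|P| , S-cond , S-minimal
    where
    P-prefix : IsPrefix P S
    P-prefix = trans (cong (λ m → take m S) |P|) (take-take-≤ D (m≤n⇒m≤1+n p≤L))
    S-minimal : ∀ q → 1 ≤ q → q < length P → ¬ SPrefCond _<ₐ_ S (take q S)
    S-minimal q 1≤q q<|P| cond =
      W-minimal q 1≤q q<p (ShorterPrefix.SPrefCond-S⇒W 1≤q q<p
        (subst (SPrefCond _<ₐ_ S) (take-q-S≡take-q-W (<⇒≤ q<p)) cond))
      where
      q<p : q < p
      q<p = subst (q <_) |P| q<|P|

  suffix-SPref : (∀ q → 1 ≤ q → q < length (factor W 1 p) → ¬ SPrefCond _<ₐ_ W (take q W)) →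
    IsSPref _<ₐ_ (factor W (suc p) (length W)) (factor W (suc p) (2 * p))
    × factor W (suc p) (2 * p) ≡ factor W 1 p
  suffix-SPref W-minimal =
    subst₂ (λ m m′ → IsSPref _<ₐ_ (take m D) (take m′ D) × take m′ D ≡ take p W)
      (sym (trans (cong (_∸ p) |W|) 1+n∸p≡1+L)) (sym (trans (m+n∸m≡n p (p + 0)) (+-identityʳ p)))
      (S-SPref (λ q 1≤q q<p → W-minimal q 1≤q (subst (q <_) (sym |take-p-W|) q<p)) , P≡take-p-W)

lemma29 : ∀ {a ℓ} {A : Set a} (_<ₐ_ : Rel A ℓ) → IsStrictTotalOrder _≡_ _<ₐ_ →
    (T : List A) → PreGalois _<ₐ_ T →
    (pe : ℕ) → IsPerE T pe →
    (z : A) →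
    AltLt _<ₐ_ (factor (T ++ z ∷ []) (suc pe) (suc (length T)))
               (factor (T ++ z ∷ []) 1 (suc (length T) ∸ pe)) →
    (p : ℕ) → IsSPref _<ₐ_ (T ++ z ∷ []) (factor (T ++ z ∷ []) 1 p) →
    p ≡ pe → 2 * p ≤ length T →
    IsSPref _<ₐ_ (factor (T ++ z ∷ []) (suc p) (length (T ++ z ∷ [])))
                 (factor (T ++ z ∷ []) (suc p) (2 * p))
    × factor (T ++ z ∷ []) (suc p) (2 * p) ≡ factor (T ++ z ∷ []) 1 p
lemma29 _ _ _ _ _ (inj₂ (_ , refl)) _ _ _ _ refl 2p≤n = ⊥-elim (1+n≰n (≤-trans (m≤m+n _ _) 2p≤n))
lemma29 _ sto T pg p (inj₁ (even-p , p-period , p-minimal)) z W-suffix≺ .p (_ , _ , _ , W-minimal) refl 2p≤n =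
  SuffixSPref.suffix-SPref sto T pg z p even-p p-period p-minimal 2p≤n W-suffix≺ W-minimal
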